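{- For every integer $j\geq 0$, the number whose decimal representation consists of the digits $18$, followed by $j$ zeros, followed by the digits $18$ (that is, $18\cdot(10^{j+2}+1)$; the numbers $1818, 18018, 180018, 1800018,\ldots$) is a $v$-palindrome.
   Context: For an integer $n\geq 1$, $r(n)$ denotes the number formed by writing the decimal digits of $n$ in reverse order. The function $v\colon\mathbb{N}\to\mathbb{Z}$ is the additive arithmetic function (i.e. $v(mn)=v(m)+v(n)$ whenever $\gcd(m,n)=1$, and $v(1)=0$) determined on prime powers by $v(p)=p$ and $v(p^\alpha)=p+\alpha$ for $\alpha\geq 2$. An integer $n\geq 1$ is a $v$-palindrome if $10\nmid n$, $n\neq r(n)$, and $v(n)=v(r(n))$. -}

module Defs where

open import Data.Nat using (ℕ; zero; suc; _+_; _*_; _^_; _≤_)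
open import Data.Nat.DivMod using (_/_; _%_)
open import Data.Nat.Divisibility using (_∣_)
open import Data.Nat.Primality using (Prime)
open import Data.Nat.Coprimality using (Coprime)
open import Data.Integer using (ℤ; +_) renaming (_+_ to _+ℤ_)
open import Data.Product using (_×_)
open import Relation.Nullary using (¬_)
open import Relation.Binary.PropositionalEquality using (_≡_; _≢_)

-- Digit reversal r(n): repeatedly strip the last decimal digit of n and
-- append it to an accumulator.  The fuel argument (initialised to n)
-- is always sufficient since n / 10 < n for n ≥ 1.
revAux : ℕ → ℕ → ℕ → ℕ
revAux zero    _       acc = acc
revAux (suc f) zero    acc = acc
revAux (suc f) (suc n) acc = revAux f (suc n / 10) (acc * 10 + suc n % 10)

r : ℕ → ℕ
r n = revAux n n 0

-- The paper's function v : ℕ → ℤ, characterised as the additive arithmetic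
-- function with v(p) = p and v(p^α) = p + α (α ≥ 2).  These conditions
-- determine v uniquely on positive integers.
record IsV (v : ℕ → ℤ) : Set where
  field
    v-one      : v 1 ≡ + 0
    v-additive : ∀ m n → 1 ≤ m → 1 ≤ n → Coprime m n →
                 v (m * n) ≡ v m +ℤ v n
    v-prime    : ∀ p → Prime p → v p ≡ + p
    v-primePow : ∀ p α → Prime p → 2 ≤ α → v (p ^ α) ≡ + (p + α)

IsVPalindrome : (ℕ → ℤ) → ℕ → Set
IsVPalindrome v n = 1 ≤ n × ¬ (10 ∣ n) × n ≢ r n × v n ≡ v (r n)

{-# OPTIONS --safe #-}
module Submission where

-- Put m = 10^(j+2) + 1.  The number 18·m is written 18 0…0 18, so its reversal
-- 81 0…0 81 is 81·m.  As m ≡ 1 (mod 2) and m ≡ 2 (mod 3), m is coprime to 18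
-- and to 81, so additivity reduces v(18·m) = v(81·m) to
-- v(18) = 2 + (3 + 2) = 7 = 3 + 4 = v(81).

open import Defs
open import Data.Nat using (ℕ; zero; suc; _+_; _*_; _^_; _≤_; _<_; _∸_; _<?_; NonZero; >-nonZero; s≤s; z≤n)
open import Data.Nat.Properties
open import Data.Nat.DivMod using (_/_; _%_; +-distrib-/-∣ʳ; m<n⇒m/n≡0; m*n/n≡m; [m+kn]%n≡m%n; m<n⇒m%n≡m)
open import Data.Nat.Divisibility using (_∣_; ∣-trans; n∣m*n; ∣m+n∣m⇒∣n; n∣m⇒m%n≡0)
open import Data.Nat.Coprimality using (Coprime; coprime?; 1-coprimeTo; coprime-divisor)
  renaming (sym to coprime-sym)
open import Data.Nat.Primality using (Prime; prime?; prime[2])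
open import Data.Nat.Tactic.RingSolver using (solve-∀)
open import Data.Integer using (ℤ; +_) renaming (_+_ to _+ℤ_)
open import Data.Product using (∃-syntax; _,_)
open import Relation.Nullary using (¬_; contradiction)
open import Relation.Nullary.Decidable using (from-yes)
open import Relation.Binary.PropositionalEquality
  using (_≡_; _≢_; refl; sym; trans; cong; cong₂; subst; module ≡-Reasoning)

revAux-nonZero : ∀ f x acc .{{_ : NonZero x}} →
                 revAux (suc f) x acc ≡ revAux f (x / 10) (acc * 10 + x % 10)
revAux-nonZero f (suc x) acc = refl

revAux-zero : ∀ f acc → revAux f 0 acc ≡ acc
revAux-zero zero    acc = refl
revAux-zero (suc f) acc = refl

revAux-digit : ∀ f {d} q acc → d < 10 → .{{_ : NonZero (d + q * 10)}} →
               revAux (suc f) (d + q * 10) acc ≡ revAux f q (acc * 10 + d)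
revAux-digit f {d} q acc d<10 =
  trans (revAux-nonZero f (d + q * 10) acc)
        (cong₂ (λ x e → revAux f x (acc * 10 + e)) quotient remainder)
  where
  open ≡-Reasoning
  quotient : (d + q * 10) / 10 ≡ q
  quotient = begin
    (d + q * 10) / 10      ≡⟨ +-distrib-/-∣ʳ d (n∣m*n q) ⟩
    d / 10 + q * 10 / 10   ≡⟨ cong₂ _+_ (m<n⇒m/n≡0 d<10) (m*n/n≡m q 10) ⟩
    q                      ∎
  remainder : (d + q * 10) % 10 ≡ d
  remainder = trans ([m+kn]%n≡m%n d q 10) (m<n⇒m%n≡m d<10)

revAux-*10^ : ∀ k f {d} acc .{{_ : NonZero d}} →
              revAux (k + f) (d * 10 ^ k) acc ≡ revAux f d (acc * 10 ^ k)
revAux-*10^ zero    f {d} acc = cong₂ (revAux f) (*-identityʳ d) (sym (*-identityʳ acc))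
revAux-*10^ (suc k) f {d} acc {{d≢0}} = begin
  revAux (suc k + f) (d * 10 ^ suc k) acc
    ≡⟨ cong (λ x → revAux (suc k + f) x acc) (shift d (10 ^ k)) ⟩
  revAux (suc (k + f)) (0 + d * 10 ^ k * 10) acc
    ≡⟨ revAux-digit (k + f) (d * 10 ^ k) acc (s≤s z≤n)
         {{m*n≢0 (d * 10 ^ k) 10 {{m*n≢0 d (10 ^ k) {{d≢0}} {{m^n≢0 10 k}}}}}} ⟩
  revAux (k + f) (d * 10 ^ k) (acc * 10 + 0)
    ≡⟨ revAux-*10^ k f (acc * 10 + 0) ⟩
  revAux f d ((acc * 10 + 0) * 10 ^ k)
    ≡⟨ cong (revAux f d) (regroup acc (10 ^ k)) ⟩
  revAux f d (acc * 10 ^ suc k) ∎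
  where
  open ≡-Reasoning
  shift : ∀ a b → a * (10 * b) ≡ 0 + a * b * 10
  shift = solve-∀
  regroup : ∀ a b → (a * 10 + 0) * b ≡ a * (10 * b)
  regroup = solve-∀

n<b^n : ∀ b → 1 < b → ∀ n → n < b ^ n
n<b^n b 1<b zero    = s≤s z≤n
n<b^n b 1<b (suc n) = begin-strict
  suc n        ≤⟨ n<b^n b 1<b n ⟩
  b ^ n        <⟨ m<m*n (b ^ n) b {{m^n≢0 b n {{>-nonZero (<-trans (s≤s z≤n) 1<b)}}}} 1<b ⟩
  b ^ n * b    ≡⟨ *-comm (b ^ n) b ⟩
  b * b ^ n    ∎
  where open ≤-Reasoning

[1+m]^n≡1+m*q : ∀ m n → ∃[ q ] (1 + m) ^ n ≡ 1 + m * q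
[1+m]^n≡1+m*q m zero    = 0 , cong suc (sym (*-zeroʳ m))
[1+m]^n≡1+m*q m (suc n) with [1+m]^n≡1+m*q m n
... | q , eq = 1 + q + m * q , trans (cong ((1 + m) *_) eq) (expand m q)
  where
  expand : ∀ m q → (1 + m) * (1 + m * q) ≡ 1 + m * (1 + q + m * q)
  expand = solve-∀

coprime-*+ : ∀ {n r} q → Coprime n r → Coprime n (q * n + r)
coprime-*+ q n⊥r (d∣n , d∣qn+r) = n⊥r (d∣n , ∣m+n∣m⇒∣n d∣qn+r (∣-trans d∣n (n∣m*n q)))

coprime-*ˡ : ∀ {a b c} → Coprime a c → Coprime b c → Coprime (a * b) c
coprime-*ˡ {a} {b} a⊥c b⊥c {d} (d∣ab , d∣c) = b⊥c (coprime-divisor d⊥a d∣ab , d∣c)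
  where
  d⊥a : Coprime d a
  d⊥a (e∣d , e∣a) = a⊥c (e∣a , ∣-trans e∣d d∣c)

coprime-^ˡ : ∀ {a c} k → Coprime a c → Coprime (a ^ k) c
coprime-^ˡ {c = c} zero    a⊥c = 1-coprimeTo c
coprime-^ˡ         (suc k) a⊥c = coprime-*ˡ a⊥c (coprime-^ˡ k a⊥c)

module _ {v : ℕ → ℤ} (isV : IsV v) where
  open IsV isV

  v[18]≡v[81] : v 18 ≡ v 81
  v[18]≡v[81] = begin
    v (2 * 9)       ≡⟨ v-additive 2 9 (s≤s z≤n) (s≤s z≤n) (from-yes (coprime? 2 9)) ⟩
    v 2 +ℤ v (3 ^ 2) ≡⟨ cong₂ _+ℤ_ (v-prime 2 prime[2]) (v-primePow 3 2 prime[3] (s≤s (s≤s z≤n))) ⟩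
    + 7             ≡⟨ sym (v-primePow 3 4 prime[3] (s≤s (s≤s z≤n))) ⟩
    v (3 ^ 4)       ∎
    where
    open ≡-Reasoning
    prime[3] : Prime 3
    prime[3] = from-yes (prime? 3)

  v-*-congʳ : ∀ {a b m} → 1 ≤ a → 1 ≤ b → 1 ≤ m → Coprime a m → Coprime b m →
              v a ≡ v b → v (a * m) ≡ v (b * m)
  v-*-congʳ {a} {b} {m} 1≤a 1≤b 1≤m a⊥m b⊥m va≡vb = begin
    v (a * m)    ≡⟨ v-additive a m 1≤a 1≤m a⊥m ⟩
    v a +ℤ v m   ≡⟨ cong (_+ℤ v m) va≡vb ⟩
    v b +ℤ v m   ≡⟨ sym (v-additive b m 1≤b 1≤m b⊥m) ⟩
    v (b * m)    ∎
    where open ≡-Reasoning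

module Bookend (j : ℕ) where

  m : ℕ
  m = 10 ^ (j + 2) + 1

  1≤m : 1 ≤ m
  1≤m = m≤n+m 1 (10 ^ (j + 2))

  m≡100*10^j+1 : m ≡ 100 * 10 ^ j + 1
  m≡100*10^j+1 = trans (cong (λ k → 10 ^ k + 1) (+-comm j 2)) (collect (10 ^ j))
    where
    collect : ∀ x → 10 * (10 * x) + 1 ≡ 100 * x + 1
    collect = solve-∀

  18m≡8+[1+18*10^j*10]*10 : 18 * m ≡ 8 + (1 + 18 * 10 ^ j * 10) * 10
  18m≡8+[1+18*10^j*10]*10 = trans (cong (18 *_) m≡100*10^j+1) (digits (10 ^ j))
    where
    digits : ∀ x → 18 * (100 * x + 1) ≡ 8 + (1 + 18 * x * 10) * 10
    digits = solve-∀

  -- Any fuel of at least j + 4, the number of digits of 18·m, suffices.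
  revAux-18m : ∀ f → revAux (2 + (j + (2 + f))) (18 * m) 0 ≡ 81 * m
  revAux-18m f = begin
    revAux (2 + (j + (2 + f))) (18 * m) 0
      ≡⟨ cong (λ x → revAux (2 + (j + (2 + f))) x 0) 18m≡8+[1+18*10^j*10]*10 ⟩
    revAux (2 + (j + (2 + f))) (8 + (1 + 18 * 10 ^ j * 10) * 10) 0
      ≡⟨ revAux-digit (1 + (j + (2 + f))) {8} (1 + 18 * 10 ^ j * 10) 0 (from-yes (8 <? 10)) ⟩
    revAux (1 + (j + (2 + f))) (1 + 18 * 10 ^ j * 10) 8
      ≡⟨ revAux-digit (j + (2 + f)) {1} (18 * 10 ^ j) 8 (s≤s (s≤s z≤n)) ⟩
    revAux (j + (2 + f)) (18 * 10 ^ j) 81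
      ≡⟨ revAux-*10^ j (2 + f) {18} 81 ⟩
    revAux (2 + f) 18 (81 * 10 ^ j)
      ≡⟨⟩
    revAux f 0 ((81 * 10 ^ j * 10 + 8) * 10 + 1)
      ≡⟨ revAux-zero f _ ⟩
    (81 * 10 ^ j * 10 + 8) * 10 + 1
      ≡⟨ sym (trans (cong (81 *_) m≡100*10^j+1) (digits (10 ^ j))) ⟩
    81 * m ∎
    where
    open ≡-Reasoning
    digits : ∀ x → 81 * (100 * x + 1) ≡ (81 * x * 10 + 8) * 10 + 1
    digits = solve-∀

  j+4≤18m : j + 4 ≤ 18 * m
  j+4≤18m = begin
    j + 4                   ≡⟨ sym (+-assoc j 2 2) ⟩
    j + 2 + 2               ≤⟨ +-monoˡ-≤ 2 (<⇒≤ (n<b^n 10 (s≤s (s≤s z≤n)) (j + 2))) ⟩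
    10 ^ (j + 2) + 2        ≤⟨ +-mono-≤ (m≤n*m (10 ^ (j + 2)) 18) (s≤s (s≤s z≤n)) ⟩
    18 * 10 ^ (j + 2) + 18  ≡⟨ sym (*-distribˡ-+ 18 (10 ^ (j + 2)) 1) ⟩
    18 * m                  ∎
    where open ≤-Reasoning

  r[18m]≡81m : r (18 * m) ≡ 81 * m
  r[18m]≡81m = trans (cong (λ fuel → revAux fuel (18 * m) 0) (sym enough-fuel)) (revAux-18m f)
    where
    f : ℕ
    f = 18 * m ∸ (j + 4)
    rearrange : ∀ a b → 2 + (a + (2 + b)) ≡ a + 4 + b
    rearrange = solve-∀
    enough-fuel : 2 + (j + (2 + f)) ≡ 18 * m
    enough-fuel = trans (rearrange j f) (m+[n∸m]≡n j+4≤18m)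

  10∤18m : ¬ 10 ∣ 18 * m
  10∤18m 10∣18m = contradiction (trans (sym (n∣m⇒m%n≡0 (18 * m) 10 10∣18m)) last-digit) λ ()
    where
    last-digit : 18 * m % 10 ≡ 8
    last-digit = trans (cong (_% 10) 18m≡8+[1+18*10^j*10]*10)
                       ([m+kn]%n≡m%n 8 (1 + 18 * 10 ^ j * 10) 10)

  18m≢81m : 18 * m ≢ 81 * m
  18m≢81m eq = contradiction (*-cancelʳ-≡ 18 81 m {{>-nonZero 1≤m}} eq) λ ()

  2⊥m : Coprime 2 m
  2⊥m = subst (Coprime 2) (sym m-odd) (coprime-*+ (50 * 10 ^ j) (coprime-sym (1-coprimeTo 2)))
    where
    halve : ∀ x → 100 * x + 1 ≡ 50 * x * 2 + 1
    halve = solve-∀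
    m-odd : m ≡ 50 * 10 ^ j * 2 + 1
    m-odd = trans m≡100*10^j+1 (halve (10 ^ j))

  3⊥m : Coprime 3 m
  3⊥m with [1+m]^n≡1+m*q 9 j
  ... | t , 10^j≡1+9t =
    subst (Coprime 3) (sym m≡2[mod3]) (coprime-*+ (33 + 300 * t) (from-yes (coprime? 3 2)))
    where
    thirds : ∀ t → 100 * (1 + 9 * t) + 1 ≡ (33 + 300 * t) * 3 + 2
    thirds = solve-∀
    m≡2[mod3] : m ≡ (33 + 300 * t) * 3 + 2
    m≡2[mod3] = trans m≡100*10^j+1 (trans (cong (λ y → 100 * y + 1) 10^j≡1+9t) (thirds t))

  18⊥m : Coprime 18 m
  18⊥m = coprime-*ˡ 2⊥m (coprime-^ˡ 2 3⊥m)

  81⊥m : Coprime 81 m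
  81⊥m = coprime-^ˡ 4 3⊥m

corollary5p3 : (v : ℕ → ℤ) → IsV v → (j : ℕ) →
                 IsVPalindrome v (18 * (10 ^ (j + 2) + 1))
corollary5p3 v isV j =
    ≤-trans 1≤m (m≤n*m m 18)
  , 10∤18m
  , (λ eq → 18m≢81m (trans eq r[18m]≡81m))
  , trans (v-*-congʳ isV (s≤s z≤n) (s≤s z≤n) 1≤m 18⊥m 81⊥m (v[18]≡v[81] isV))
          (cong v (sym r[18m]≡81m))
  where open Bookend j
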